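{- Let $A$ be a finite nonempty alphabet and let $S\subset A^*$ be a uniformly recurrent connected set with $A\subset S$. Then for every $w\in S$, the set $\mathcal{R}_S(w)$ of first right return words to $w$ generates the free group $F_A$.
   Context: $A^+=A^*\setminus\{1\}$. $S$ is factorial if it contains all factors of its elements. For $w\in S$: $L(w)=\{a\in A\mid aw\in S\}$, $R(w)=\{a\in A\mid wa\in S\}$, $E(w)=\{(a,b)\mid awb\in S\}$; $S$ is biextendable if it is factorial and $E(w)\ne\emptyset$ for all $w\in S$; right-extendable if factorial and $R(w)\ne\emptyset$ for all $w$. The extension graph of $w$ is the undirected bipartite graph with vertex set the disjoint union of $L(w)$ and $R(w)$ and an edge $a$–$b$ for each $(a,b)\in E(w)$. $S$ is connected if it is biextendable and every extension graph is connected. $S$ is uniformly recurrent if it is right-extendable and for every $u\in S$ there is $n\ge1$ such that $u$ is a factor of every word of $S$ of length $n$. $\Gamma_S(w)=\{x\in S\mid wx\in S\cap A^+w\}$ and $\mathcal{R}_S(w)=\Gamma_S(w)\setminus\Gamma_S(w)A^+$. -}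

module Defs where

open import Level using (0ℓ)
open import Data.Nat using (ℕ; suc; _≥_)
open import Data.Fin using (Fin)
open import Data.Bool using (Bool; true; false; not)
open import Data.List using (List; []; _∷_; _++_; [_]; map; reverse; concat; length)
open import Data.Product using (Σ; ∃; ∃-syntax; _×_; _,_; proj₁; proj₂)
open import Data.Sum using (_⊎_; inj₁; inj₂)
open import Data.Empty using (⊥)
open import Relation.Nullary using (¬_)
open import Relation.Binary.PropositionalEquality using (_≡_; _≢_)
open import Relation.Binary.Construct.Closure.ReflexiveTransitive using (Star)
open import Relation.Binary.Construct.Closure.Equivalence using (EqClosure)

Word : ℕ → Set
Word n = List (Fin n)

WordSet : ℕ → Set₁
WordSet n = Word n → Set

module _ {n : ℕ} where

  IsFactor : Word n → Word n → Set
  IsFactor u v = ∃[ p ] ∃[ s ] (v ≡ p ++ u ++ s)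

  Factorial : WordSet n → Set
  Factorial S = ∀ u v → S v → IsFactor u v → S u

  LeftExt : WordSet n → Word n → Fin n → Set
  LeftExt S w a = S (a ∷ w)

  RightExt : WordSet n → Word n → Fin n → Set
  RightExt S w b = S (w ++ [ b ])

  BiExt : WordSet n → Word n → Fin n → Fin n → Set
  BiExt S w a b = S (a ∷ w ++ [ b ])

  Biextendable : WordSet n → Set
  Biextendable S = Factorial S × (∀ w → S w → ∃[ a ] ∃[ b ] BiExt S w a b)

  RightExtendable : WordSet n → Set
  RightExtendable S = Factorial S × (∀ w → S w → ∃[ b ] RightExt S w b)

  -- Extension graph of w: vertices inj₁ a (a ∈ L(w)) and inj₂ b (b ∈ R(w));
  -- an (undirected) edge a – b for each (a,b) ∈ E(w).
  ExtVertex : WordSet n → Word n → Fin n ⊎ Fin n → Set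
  ExtVertex S w (inj₁ a) = LeftExt S w a
  ExtVertex S w (inj₂ b) = RightExt S w b

  ExtEdge : WordSet n → Word n → Fin n ⊎ Fin n → Fin n ⊎ Fin n → Set
  ExtEdge S w (inj₁ a) (inj₂ b) = BiExt S w a b
  ExtEdge S w (inj₂ b) (inj₁ a) = BiExt S w a b
  ExtEdge S w (inj₁ _) (inj₁ _) = ⊥
  ExtEdge S w (inj₂ _) (inj₂ _) = ⊥

  ExtGraphConnected : WordSet n → Word n → Set
  ExtGraphConnected S w =
    ∀ x y → ExtVertex S w x → ExtVertex S w y → Star (ExtEdge S w) x y

  Connected : WordSet n → Set
  Connected S = Biextendable S × (∀ w → S w → ExtGraphConnected S w)

  UniformlyRecurrent : WordSet n → Set
  UniformlyRecurrent S =
    RightExtendable S ×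
    (∀ u → S u → ∃[ m ] (m ≥ 1 × (∀ v → S v → length v ≡ m → IsFactor u v)))

  NonEmpty : Word n → Set
  NonEmpty u = u ≢ []

  Γ : WordSet n → Word n → Word n → Set
  Γ S w x = S x × S (w ++ x) × (∃[ u ] (NonEmpty u × w ++ x ≡ u ++ w))

  ReturnWord : WordSet n → Word n → Word n → Set
  ReturnWord S w x =
    Γ S w x × ¬ (∃[ y ] ∃[ z ] (Γ S w y × NonEmpty z × x ≡ y ++ z))

  -- The free group F_A on A = Fin n: words over A × {±1} (true = a, false = a⁻¹)
  -- modulo the equivalence generated by deleting a factor x x⁻¹.
  FWord : Set
  FWord = List (Fin n × Bool)

  data FreeStep : FWord → FWord → Set where
    cancel : ∀ p q a b → FreeStep (p ++ (a , b) ∷ (a , not b) ∷ q) (p ++ q)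

  _≈F_ : FWord → FWord → Set
  _≈F_ = EqClosure FreeStep

  ι : Word n → FWord
  ι = map (λ a → (a , true))

  finv : FWord → FWord
  finv g = reverse (map (λ { (a , b) → (a , not b) }) g)

  pow : FWord → Bool → FWord
  pow g true = g
  pow g false = finv g

  GeneratesFreeGroup : (Word n → Set) → Set
  GeneratesFreeGroup X =
    ∀ (g : FWord) → ∃[ ρ ] (g ≈F concat (map (λ (p : Σ (Word n) X × Bool) → pow (ι (proj₁ (proj₁ p))) (proj₂ p)) ρ))

module Submission where

-- Label each edge of a Rauzy graph of S by the letter it appends, inverted when the edge is
-- traversed backwards. Since every extension graph is connected, a walk between words of length k
-- lifts to a walk between words of length k + 1 with the same label in F_A; by induction every
-- element of F_A is the label of a closed walk at every vertex. At a vertex sw that is long enough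
-- for uniform recurrence, every vertex of the walk contains w, and following one occurrence of w
-- along the walk writes the label as a product of elements of Γ(w) and their inverses. Finally,
-- each element of Γ(w) is a concatenation of first return words.

open import Defs
open import Data.Nat using (ℕ; zero; suc; _+_; _≤_; s≤s)
open import Data.Nat.Properties
  using (module ≤-Reasoning; suc-injective; +-cancelʳ-≤; +-monoʳ-≤; m≤n⇒m≤1+n; m≤n⇒m⊓n≡m)
open import Data.Fin as Fin using (Fin)
open import Data.Bool using (Bool; true; false; not)
open import Data.Bool.Properties using (not-involutive)
open import Data.List using (List; []; _∷_; _++_; [_]; map; concat; length; take; drop; initLast; _∷ʳ′_)
open import Data.List.Properties
  using (++-assoc; ++-identityʳ; map-++; concat-++; length-++; length-++-comm; length-++-≤ˡ; length-++-≤ʳ; length-take; take++drop≡id;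
         unfold-reverse; ∷ʳ-injective; ++-identityʳ-unique; ++-identityˡ-unique; ++-conicalʳ; ≡-dec; ∷-injective)
open import Data.Product using (Σ; ∃-syntax; _×_; _,_; proj₁; proj₂)
open import Data.Sum using (_⊎_; inj₁; inj₂)
open import Data.Empty using (⊥-elim)
open import Function using (case_of_)
open import Relation.Nullary using (¬_; Dec; yes; no)
open import Relation.Nullary.Decidable using (map′)
open import Relation.Binary.Bundles using (Setoid)
open import Relation.Binary.PropositionalEquality
  using (_≡_; _≢_; refl; sym; trans; cong; cong₂; subst; subst₂; module ≡-Reasoning)
open import Relation.Binary.Construct.Closure.ReflexiveTransitive using (Star; ε; _◅_)
open import Relation.Binary.Construct.Closure.Symmetric using (fwd)
import Relation.Binary.Construct.Closure.Equivalence as EqClosure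
import Relation.Binary.Reasoning.Setoid

module _ {n : ℕ} where

  FreeGroup : Setoid _ _
  FreeGroup = EqClosure.setoid (FreeStep {n})

  open Setoid FreeGroup public using ()
    renaming (refl to ≈F-refl; sym to ≈F-sym; trans to ≈F-trans; reflexive to ≡⇒≈F)

  module ≈F-Reasoning = Relation.Binary.Reasoning.Setoid FreeGroup

  cancel-head : ∀ a b (q : FWord {n}) → ((a , b) ∷ (a , not b) ∷ q) ≈F q
  cancel-head a b q = fwd (cancel [] q a b) ◅ ε

  cancel-head′ : ∀ a b (q : FWord {n}) → ((a , not b) ∷ (a , b) ∷ q) ≈F q
  cancel-head′ a true  = cancel-head a false
  cancel-head′ a false = cancel-head a true

  ++-congˡ : ∀ (h : FWord {n}) {g g′} → g ≈F g′ → (h ++ g) ≈F (h ++ g′)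
  ++-congˡ h = EqClosure.gmap (h ++_) step
    where
    step : ∀ {g g′} → FreeStep g g′ → FreeStep (h ++ g) (h ++ g′)
    step (cancel p q a b) = subst₂ FreeStep (++-assoc h p _) (++-assoc h p q) (cancel (h ++ p) q a b)

  ++-congʳ : ∀ (h : FWord {n}) {g g′} → g ≈F g′ → (g ++ h) ≈F (g′ ++ h)
  ++-congʳ h = EqClosure.gmap (_++ h) step
    where
    step : ∀ {g g′} → FreeStep g g′ → FreeStep (g ++ h) (g′ ++ h)
    step (cancel p q a b) =
      subst₂ FreeStep (sym (++-assoc p _ h)) (sym (++-assoc p q h)) (cancel p (q ++ h) a b)

  ++-cong : ∀ {g g′ h h′ : FWord {n}} → g ≈F g′ → h ≈F h′ → (g ++ h) ≈F (g′ ++ h′)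
  ++-cong {g′ = g′} {h = h} g≈g′ h≈h′ = ≈F-trans (++-congʳ h g≈g′) (++-congˡ g′ h≈h′)

  finv-∷ : ∀ a b (g : FWord {n}) → finv ((a , b) ∷ g) ≡ finv g ++ [ (a , not b) ]
  finv-∷ a b g = unfold-reverse (a , not b) (map _ g)

  finv-++ : ∀ (g h : FWord {n}) → finv (g ++ h) ≡ finv h ++ finv g
  finv-++ [] h = sym (++-identityʳ (finv h))
  finv-++ ((a , b) ∷ g) h = begin
    finv ((a , b) ∷ g ++ h)            ≡⟨ finv-∷ a b (g ++ h) ⟩
    finv (g ++ h) ++ [ (a , not b) ]   ≡⟨ cong (_++ [ (a , not b) ]) (finv-++ g h) ⟩
    (finv h ++ finv g) ++ [ (a , not b) ] ≡⟨ ++-assoc (finv h) (finv g) _ ⟩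
    finv h ++ (finv g ++ [ (a , not b) ]) ≡⟨ cong (finv h ++_) (finv-∷ a b g) ⟨
    finv h ++ finv ((a , b) ∷ g)       ∎
    where open ≡-Reasoning

  finv-involutive : ∀ (g : FWord {n}) → finv (finv g) ≡ g
  finv-involutive [] = refl
  finv-involutive ((a , b) ∷ g) = begin
    finv (finv ((a , b) ∷ g))          ≡⟨ cong finv (finv-∷ a b g) ⟩
    finv (finv g ++ [ (a , not b) ])   ≡⟨ finv-++ (finv g) _ ⟩
    (a , not (not b)) ∷ finv (finv g)  ≡⟨ cong₂ (λ c h → (a , c) ∷ h) (not-involutive b) (finv-involutive g) ⟩
    (a , b) ∷ g                        ∎
    where open ≡-Reasoning

  finv-cong : ∀ {g h : FWord {n}} → g ≈F h → finv g ≈F finv h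
  finv-cong = EqClosure.gmap finv step
    where
    finv-cancel : ∀ p q a b → finv (p ++ (a , b) ∷ (a , not b) ∷ q) ≡ finv q ++ (a , not (not b)) ∷ (a , not b) ∷ finv p
    finv-cancel p q a b = begin
      finv (p ++ (a , b) ∷ (a , not b) ∷ q)          ≡⟨ finv-++ p _ ⟩
      finv ((a , b) ∷ (a , not b) ∷ q) ++ finv p      ≡⟨ cong (_++ finv p) (finv-++ ((a , b) ∷ (a , not b) ∷ []) q) ⟩
      (finv q ++ finv ((a , b) ∷ (a , not b) ∷ [])) ++ finv p ≡⟨ ++-assoc (finv q) _ _ ⟩
      finv q ++ (a , not (not b)) ∷ (a , not b) ∷ finv p ∎
      where open ≡-Reasoning
    step : ∀ {g h} → FreeStep g h → FreeStep (finv g) (finv h)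
    step (cancel p q a true)  = subst₂ FreeStep (sym (finv-cancel p q a true))  (sym (finv-++ p q)) (cancel (finv q) (finv p) a true)
    step (cancel p q a false) = subst₂ FreeStep (sym (finv-cancel p q a false)) (sym (finv-++ p q)) (cancel (finv q) (finv p) a false)

  finv-inverseˡ : ∀ (g : FWord {n}) → (finv g ++ g) ≈F []
  finv-inverseˡ [] = ≈F-refl
  finv-inverseˡ ((a , b) ∷ g) = begin
    finv ((a , b) ∷ g) ++ (a , b) ∷ g        ≡⟨ cong (_++ (a , b) ∷ g) (finv-∷ a b g) ⟩
    (finv g ++ [ (a , not b) ]) ++ (a , b) ∷ g ≡⟨ ++-assoc (finv g) _ _ ⟩
    finv g ++ (a , not b) ∷ (a , b) ∷ g       ≈⟨ ++-congˡ (finv g) (cancel-head′ a b g) ⟩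
    finv g ++ g                              ≈⟨ finv-inverseˡ g ⟩
    []                                       ∎
    where open ≈F-Reasoning

  generator : (X : Word n → Set) → Σ (Word n) X × Bool → FWord {n}
  generator X ((x , _) , b) = pow (ι x) b

  ⟨_⟩ : (Word n → Set) → FWord {n} → Set
  ⟨ X ⟩ g = ∃[ ρ ] (g ≈F concat (map (generator X) ρ))

  module _ {X : Word n → Set} where

    ⟨⟩-ε : ⟨ X ⟩ []
    ⟨⟩-ε = [] , ≈F-refl

    ⟨⟩-resp-≈ : ∀ {g h} → g ≈F h → ⟨ X ⟩ g → ⟨ X ⟩ h
    ⟨⟩-resp-≈ g≈h (ρ , g≈ρ) = ρ , ≈F-trans (≈F-sym g≈h) g≈ρ

    ⟨⟩-++ : ∀ {g h} → ⟨ X ⟩ g → ⟨ X ⟩ h → ⟨ X ⟩ (g ++ h)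
    ⟨⟩-++ (ρ , g≈ρ) (σ , h≈σ) = ρ ++ σ , ≈F-trans (++-cong g≈ρ h≈σ) (≡⇒≈F (begin
      concat (map (generator X) ρ) ++ concat (map (generator X) σ) ≡⟨ concat-++ (map (generator X) ρ) _ ⟩
      concat (map (generator X) ρ ++ map (generator X) σ)          ≡⟨ cong concat (map-++ (generator X) ρ σ) ⟨
      concat (map (generator X) (ρ ++ σ))                           ∎))
      where open ≡-Reasoning

    ⟨⟩-pow : ∀ {x} → X x → ∀ b → ⟨ X ⟩ (pow (ι x) b)
    ⟨⟩-pow {x} x∈X b = [ ((x , x∈X) , b) ] , ≡⇒≈F (sym (++-identityʳ (pow (ι x) b)))

    ⟨⟩-finv : ∀ {g} → ⟨ X ⟩ g → ⟨ X ⟩ (finv g)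
    ⟨⟩-finv (ρ , g≈ρ) = ⟨⟩-resp-≈ (≈F-sym (finv-cong g≈ρ)) (finv-product ρ)
      where
      finv-pow : ∀ {x} → X x → ∀ b → ⟨ X ⟩ (finv (pow (ι x) b))
      finv-pow x∈X true = ⟨⟩-pow x∈X false
      finv-pow {x} x∈X false = subst ⟨ X ⟩ (sym (finv-involutive (ι x))) (⟨⟩-pow x∈X true)

      finv-product : ∀ ρ → ⟨ X ⟩ (finv (concat (map (generator X) ρ)))
      finv-product [] = ⟨⟩-ε
      finv-product (((x , x∈X) , b) ∷ ρ) =
        subst ⟨ X ⟩ (sym (finv-++ (pow (ι x) b) _)) (⟨⟩-++ (finv-product ρ) (finv-pow x∈X b))

  X⊆⟨Y⟩⇒⟨X⟩⊆⟨Y⟩ : ∀ {X Y : Word n → Set} → (∀ {x} → X x → ⟨ Y ⟩ (ι x)) → ∀ {g} → ⟨ X ⟩ g → ⟨ Y ⟩ g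
  X⊆⟨Y⟩⇒⟨X⟩⊆⟨Y⟩ {X} {Y} X⊆⟨Y⟩ (ρ , g≈ρ) = ⟨⟩-resp-≈ (≈F-sym g≈ρ) (product ρ)
    where
    product : ∀ ρ → ⟨ Y ⟩ (concat (map (generator X) ρ))
    product [] = ⟨⟩-ε
    product (((x , x∈X) , true) ∷ ρ) = ⟨⟩-++ (X⊆⟨Y⟩ x∈X) (product ρ)
    product (((x , x∈X) , false) ∷ ρ) = ⟨⟩-++ (⟨⟩-finv (X⊆⟨Y⟩ x∈X)) (product ρ)

module _ {A : Set} where

  levi : ∀ (a b c d : List A) → a ++ b ≡ c ++ d → length a ≤ length c →
         ∃[ x ] (c ≡ a ++ x × b ≡ x ++ d)
  levi []      b c       d eq _ = c , refl , eq
  levi (x ∷ a) b (y ∷ c) d eq (s≤s |a|≤|c|) with refl , eq′ ← ∷-injective eq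
    with r , c≡a++r , b≡r++d ← levi a b c d eq′ |a|≤|c| = r , cong (x ∷_) c≡a++r , b≡r++d

  leviʳ : ∀ (a b c d : List A) → a ++ b ≡ c ++ d → length d ≤ length b →
          ∃[ x ] (c ≡ a ++ x × b ≡ x ++ d)
  leviʳ a b c d eq |d|≤|b| = levi a b c d eq (+-cancelʳ-≤ (length b) (length a) (length c) (begin
    length a + length b ≡⟨ length-++ a ⟨
    length (a ++ b)     ≡⟨ cong length eq ⟩
    length (c ++ d)     ≡⟨ length-++ c ⟩
    length c + length d ≤⟨ +-monoʳ-≤ (length c) |d|≤|b| ⟩
    length c + length b ∎))
    where open ≤-Reasoning

  snoc-prefix : ∀ (p y z : List A) {c} → p ++ [ c ] ≡ y ++ z → z ≢ [] → ∃[ z′ ] (p ≡ y ++ z′)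
  snoc-prefix p y z eq z≢[] with initLast z
  ... | []       = ⊥-elim (z≢[] refl)
  ... | z′ ∷ʳ′ d = z′ , proj₁ (∷ʳ-injective p (y ++ z′) (trans eq (sym (++-assoc y z′ [ d ]))))

module _ {n : ℕ} where

  Suffix : Word n → Word n → Set
  Suffix w v = ∃[ u ] (v ≡ u ++ w)

  ProperSuffix : Word n → Word n → Set
  ProperSuffix w v = ∃[ u ] (NonEmpty u × v ≡ u ++ w)

  suffix? : ∀ w v → Dec (Suffix w v)
  suffix? w v with ≡-dec Fin._≟_ v w
  ... | yes v≡w = yes ([] , v≡w)
  suffix? w []      | no v≢w = no λ { ([] , e) → v≢w e ; (_ ∷ _ , ()) }
  suffix? w (c ∷ v) | no v≢w = map′
    (λ (u , e) → c ∷ u , cong (c ∷_) e)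
    (λ { ([] , e) → ⊥-elim (v≢w e) ; (_ ∷ u , e) → u , proj₂ (∷-injective e) })
    (suffix? w v)

  properSuffix? : ∀ w v → Dec (ProperSuffix w v)
  properSuffix? w []      = no λ { ([] , u≢[] , _) → u≢[] refl ; (_ ∷ _ , _ , ()) }
  properSuffix? w (c ∷ v) = map′
    (λ (u , e) → c ∷ u , (λ ()) , cong (c ∷_) e)
    (λ { ([] , u≢[] , _) → ⊥-elim (u≢[] refl) ; (_ ∷ u , _ , e) → u , proj₂ (∷-injective e) })
    (suffix? w v)

  ¬properSuffix-self : ∀ w → ¬ ProperSuffix w w
  ¬properSuffix-self w (u , u≢[] , w≡u++w) = u≢[] (++-identityˡ-unique u w≡u++w)

module FactorialSet {n : ℕ} {S : WordSet n} (factorial : Factorial S) where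

  prefix∈S : ∀ u v → S (u ++ v) → S u
  prefix∈S u v uv∈S = factorial u (u ++ v) uv∈S ([] , v , refl)

  suffix∈S : ∀ u v → S (u ++ v) → S v
  suffix∈S u v uv∈S = factorial v (u ++ v) uv∈S (u , [] , cong (u ++_) (sym (++-identityʳ v)))

  module ReturnWords (w : Word n) where

    Γ-intro : ∀ {x} → S (w ++ x) → ProperSuffix w (w ++ x) → Γ S w x
    Γ-intro {x} wx∈S ends = suffix∈S w x wx∈S , wx∈S , ends

    occurrence⇒Γ : ∀ p q t → S (q ++ w) → q ++ w ≡ p ++ w ++ t → NonEmpty t → Γ S w t
    occurrence⇒Γ p q t qw∈S qw≡pwt t≢[]
      with x , _ , wt≡xw ← leviʳ p (w ++ t) q w (sym qw≡pwt) (length-++-≤ˡ w)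
      = Γ-intro (suffix∈S p (w ++ t) (subst S qw≡pwt qw∈S)) (x , x≢[] , wt≡xw)
      where
      x≢[] : NonEmpty x
      x≢[] refl = t≢[] (++-identityʳ-unique w (sym wt≡xw))

    private
      NoReturnIn : Word n → Set
      NoReturnIn p = ∀ y z → p ≡ y ++ z → ¬ ProperSuffix w (w ++ y)

      noReturnIn-[] : NoReturnIn []
      noReturnIn-[] [] _ _ = subst (λ v → ¬ ProperSuffix w v) (sym (++-identityʳ w)) (¬properSuffix-self w)
      noReturnIn-[] (_ ∷ _) _ ()

    -- Reading p ++ q from the left, p is what has been read since the last return to w.
    Γ⊆⟨R⟩′ : ∀ p q → NoReturnIn p → Γ S w (p ++ q) → ⟨ ReturnWord S w ⟩ (ι (p ++ q))
    Γ⊆⟨R⟩′ p [] noReturn (_ , _ , ends) =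
      ⊥-elim (noReturn p [] (sym (++-identityʳ p)) (subst (λ x → ProperSuffix w (w ++ x)) (++-identityʳ p) ends))
    Γ⊆⟨R⟩′ p (c ∷ q) noReturn γ@(_ , wx∈S , v , _ , wx≡vw) with properSuffix? w (w ++ p ++ [ c ])
    ... | no ¬ends = subst (λ x → ⟨ ReturnWord S w ⟩ (ι x)) (++-assoc p [ c ] q)
          (Γ⊆⟨R⟩′ (p ++ [ c ]) q noReturn′ (subst (Γ S w) (sym (++-assoc p [ c ] q)) γ))
      where
      noReturn′ : NoReturnIn (p ++ [ c ])
      noReturn′ y []        e = subst (λ y → ¬ ProperSuffix w (w ++ y)) (trans e (++-identityʳ y)) ¬ends
      noReturn′ y z@(_ ∷ _) e with z′ , p≡yz′ ← snoc-prefix p y z e (λ ()) = noReturn y z′ p≡yz′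
    ... | yes ends@(u , _ , wpc≡uw) = subst (λ x → ⟨ ReturnWord S w ⟩ (ι x)) (++-assoc p [ c ] q)
          (subst (⟨ ReturnWord S w ⟩) (sym (map-++ _ (p ++ [ c ]) q))
            (⟨⟩-++ (⟨⟩-pow returnWord true) (rest q refl)))
      where
      wx≡wpc++q : w ++ p ++ c ∷ q ≡ (w ++ p ++ [ c ]) ++ q
      wx≡wpc++q = sym (trans (++-assoc w (p ++ [ c ]) q) (cong (w ++_) (++-assoc p [ c ] q)))

      returnWord : ReturnWord S w (p ++ [ c ])
      returnWord = Γ-intro (prefix∈S (w ++ p ++ [ c ]) q (subst S wx≡wpc++q wx∈S)) ends ,
        λ (y , z , (_ , _ , y-ends) , z≢[] , pc≡yz) →
          let z′ , p≡yz′ = snoc-prefix p y z pc≡yz z≢[] in noReturn y z′ p≡yz′ y-ends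

      rest : ∀ q′ → q′ ≡ q → ⟨ ReturnWord S w ⟩ (ι q′)
      rest []         _    = ⟨⟩-ε
      rest q′@(_ ∷ _) refl = Γ⊆⟨R⟩′ [] q′ noReturnIn-[]
        (occurrence⇒Γ u v q′ (subst S wx≡vw wx∈S) (begin
          v ++ w              ≡⟨ wx≡vw ⟨
          w ++ p ++ c ∷ q     ≡⟨ wx≡wpc++q ⟩
          (w ++ p ++ [ c ]) ++ q ≡⟨ cong (_++ q) wpc≡uw ⟩
          (u ++ w) ++ q       ≡⟨ ++-assoc u w q ⟩
          u ++ w ++ q         ∎) (λ ()))
        where open ≡-Reasoning

    Γ⊆⟨R⟩ : ∀ {x} → Γ S w x → ⟨ ReturnWord S w ⟩ (ι x)
    Γ⊆⟨R⟩ {x} = Γ⊆⟨R⟩′ [] x noReturnIn-[]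

  Edge : Word n → Fin n → Word n → Set
  Edge u b u′ = S (u ++ [ b ]) × ∃[ c ] (c ∷ u′ ≡ u ++ [ b ])

  edge-source∈S : ∀ {u b u′} → Edge u b u′ → S u
  edge-source∈S {u} {b} (ub∈S , _) = prefix∈S u [ b ] ub∈S

  edge-target∈S : ∀ {u b u′} → Edge u b u′ → S u′
  edge-target∈S {u′ = u′} (ub∈S , c , cu′≡ub) = suffix∈S [ c ] u′ (subst S (sym cu′≡ub) ub∈S)

  edge-length : ∀ {u b u′} → Edge u b u′ → length u′ ≡ length u
  edge-length {u} {b} (_ , _ , cu′≡ub) = suc-injective (trans (cong length cu′≡ub) (length-++-comm u [ b ]))

  data Walk : Word n → Word n → FWord {n} → Set where
    nil      : ∀ {u} → Walk u u []
    forward  : ∀ {u u′ u″ b ℓ} → Edge u b u′ → Walk u′ u″ ℓ → Walk u u″ ((b , true) ∷ ℓ)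
    backward : ∀ {u u′ u″ b ℓ} → Edge u′ b u → Walk u′ u″ ℓ → Walk u u″ ((b , false) ∷ ℓ)

  _++ʷ_ : ∀ {u u′ u″ ℓ ℓ′} → Walk u u′ ℓ → Walk u′ u″ ℓ′ → Walk u u″ (ℓ ++ ℓ′)
  nil          ++ʷ q = q
  forward  e p ++ʷ q = forward  e (p ++ʷ q)
  backward e p ++ʷ q = backward e (p ++ʷ q)

  module ExtensionGraph (w : Word n) where

    vertex : Fin n ⊎ Fin n → Word n
    vertex (inj₁ a) = a ∷ w
    vertex (inj₂ b) = w ++ [ b ]

    potential : Fin n ⊎ Fin n → FWord {n}
    potential (inj₁ _) = []
    potential (inj₂ b) = [ (b , true) ]

    path⇒walk : ∀ {x y} → Star (ExtEdge S w) x y →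
                ∃[ ℓ ] (Walk (vertex x) (vertex y) ℓ × (potential x ++ ℓ) ≈F potential y)
    path⇒walk ε = [] , nil , ≡⇒≈F (++-identityʳ _)
    path⇒walk (_◅_ {inj₁ a} {inj₂ b} awb∈S path) with ℓ , walk , ℓ≈ ← path⇒walk path =
      (b , true) ∷ ℓ , forward (awb∈S , a , refl) walk , ℓ≈
    path⇒walk (_◅_ {inj₂ b} {inj₁ a} awb∈S path) with ℓ , walk , ℓ≈ ← path⇒walk path =
      (b , false) ∷ ℓ , backward (awb∈S , a , refl) walk , ≈F-trans (cancel-head b true ℓ) ℓ≈

  module Connectedness
    (biextendable : ∀ w → S w → ∃[ a ] ∃[ b ] BiExt S w a b)
    (connected : ∀ w → S w → ExtGraphConnected S w)
    where

    leftExtension : ∀ {u} → S u → ∃[ a ] S (a ∷ u)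
    leftExtension {u} u∈S with a , b , aub∈S ← biextendable u u∈S = a , prefix∈S (a ∷ u) [ b ] aub∈S

    leftExtensions : ∀ {u} → S u → ∀ k → ∃[ s ] (length s ≡ k × S (s ++ u))
    leftExtensions u∈S zero = [] , refl , u∈S
    leftExtensions u∈S (suc k) with s , |s|≡k , su∈S ← leftExtensions u∈S k
      with a , asu∈S ← leftExtension su∈S = a ∷ s , cong suc |s|≡k , asu∈S

    private
      extensionPath : ∀ {w} → S w → ∀ x y → ExtVertex S w x → ExtVertex S w y →
        let open ExtensionGraph w in
        ∃[ ℓ ] (Walk (vertex x) (vertex y) ℓ × (potential x ++ ℓ) ≈F potential y)
      extensionPath {w} w∈S x y x∈ y∈ = ExtensionGraph.path⇒walk w (connected w w∈S x y x∈ y∈)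

    -- Each step is rerouted through the (connected) extension graph of its source.
    liftWalk : ∀ {w w′ ℓ a} → Walk w w′ ℓ → S (a ∷ w) →
               ∃[ a′ ] (S (a′ ∷ w′) × ∃[ ℓ′ ] (Walk (a ∷ w) (a′ ∷ w′) ℓ′ × ℓ′ ≈F ℓ))
    liftWalk {a = a} nil aw∈S = a , aw∈S , [] , nil , ≈F-refl
    liftWalk {w} {a = a} (forward {u′ = w₁} {b = b} (wb∈S , c , cw₁≡wb) walk) aw∈S
      with ℓ₁ , walk₁ , ℓ₁≈b ← extensionPath (suffix∈S [ a ] w aw∈S) (inj₁ a) (inj₂ b) aw∈S wb∈S
      with a′ , a′w′∈S , ℓ₂ , walk₂ , ℓ₂≈ ← liftWalk walk (subst S (sym cw₁≡wb) wb∈S)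
      = a′ , a′w′∈S , ℓ₁ ++ ℓ₂ , subst (λ v → Walk (a ∷ w) v ℓ₁) (sym cw₁≡wb) walk₁ ++ʷ walk₂ , ++-cong ℓ₁≈b ℓ₂≈
    liftWalk {w} {a = a} (backward {u′ = w₁} {b = b} e@(w₁b∈S , c , cw≡w₁b) walk) aw∈S
      with ℓ₁ , walk₁ , ℓ₁≈ε ← extensionPath (suffix∈S [ a ] w aw∈S) (inj₁ a) (inj₁ c) aw∈S (subst S (sym cw≡w₁b) w₁b∈S)
      with d , dw₁b∈S ← leftExtension w₁b∈S
      with a′ , a′w′∈S , ℓ₂ , walk₂ , ℓ₂≈ ← liftWalk walk (prefix∈S (d ∷ w₁) [ b ] dw₁b∈S)
      = a′ , a′w′∈S , ℓ₁ ++ (b , false) ∷ ℓ₂ ,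
        walk₁ ++ʷ backward (dw₁b∈S , d , cong (d ∷_) cw≡w₁b) walk₂ ,
        ++-cong ℓ₁≈ε (++-congˡ [ (b , false) ] ℓ₂≈)

    closedWalk : (∀ a → S [ a ]) → ∀ {v} → S v → ∀ g → ∃[ ℓ ] (Walk v v ℓ × ℓ ≈F g)
    closedWalk letters {[]} _ g = g , loop g , ≈F-refl
      where
      loop : ∀ g → Walk [] [] g
      loop []              = nil
      loop ((a , true)  ∷ g) = forward  (letters a , a , refl) (loop g)
      loop ((a , false) ∷ g) = backward (letters a , a , refl) (loop g)
    closedWalk letters {a ∷ w} aw∈S g
      with ℓ , walk , ℓ≈g ← closedWalk letters (suffix∈S [ a ] w aw∈S) g
      with a′ , a′w∈S , ℓ₁ , walk₁ , ℓ₁≈ℓ ← liftWalk walk aw∈S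
      with ℓ₂ , walk₂ , ℓ₂≈ε ← extensionPath (suffix∈S [ a ] w aw∈S) (inj₁ a′) (inj₁ a) a′w∈S aw∈S
      = ℓ₁ ++ ℓ₂ , walk₁ ++ʷ walk₂ , ≈F-trans (++-cong ℓ₁≈ℓ ℓ₂≈ε) (≈F-trans (≡⇒≈F (++-identityʳ ℓ)) ℓ≈g)

  module Recurrence (w : Word n) (m : ℕ) (recurrent : ∀ v → S v → length v ≡ m → IsFactor w v) where

    open ReturnWords w

    occurrence : ∀ {u} → S u → m ≤ length u → ∃[ s ] ∃[ t ] (u ≡ s ++ w ++ t)
    occurrence {u} u∈S m≤|u|
      with p , q , prefix≡pwq ← recurrent (take m u) (prefix∈S (take m u) (drop m u) (subst S (sym (take++drop≡id m u)) u∈S))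
                                  (trans (length-take m u) (m≤n⇒m⊓n≡m m≤|u|))
      = p , q ++ drop m u , (begin
        u                          ≡⟨ take++drop≡id m u ⟨
        take m u ++ drop m u       ≡⟨ cong (_++ drop m u) prefix≡pwq ⟩
        (p ++ w ++ q) ++ drop m u  ≡⟨ ++-assoc p (w ++ q) _ ⟩
        p ++ (w ++ q) ++ drop m u  ≡⟨ cong (p ++_) (++-assoc w q _) ⟩
        p ++ w ++ q ++ drop m u    ∎)
      where open ≡-Reasoning

    -- Starting from a vertex in which w occurs followed by t, the walk with label ℓ ends in u′,
    -- where w occurs followed by t′ and t ℓ = h t′ with h ∈ ⟨Γ(w)⟩.
    Reanchored : Word n → FWord {n} → Word n → Set
    Reanchored t ℓ u′ =
      ∃[ s′ ] ∃[ t′ ] (u′ ≡ s′ ++ w ++ t′ × ∃[ h ] (⟨ Γ S w ⟩ h × (ι t ++ ℓ) ≈F (h ++ ι t′)))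

    forward-step : ∀ {u b u′} s t → Edge u b u′ → m ≤ length u′ → u ≡ s ++ w ++ t → Reanchored t [ (b , true) ] u′
    forward-step {b = b} {u′} (d ∷ s) t (_ , c , cu′≡ub) _ refl =
      s , t ++ [ b ] , u′≡swtb , [] , ⟨⟩-ε , ≡⇒≈F (sym (map-++ _ t [ b ]))
      where
      u′≡swtb : u′ ≡ s ++ w ++ t ++ [ b ]
      u′≡swtb = trans (proj₂ (∷-injective cu′≡ub))
                      (trans (++-assoc s (w ++ t) [ b ]) (cong (s ++_) (++-assoc w t [ b ])))
    forward-step {b = b} {u′} [] t e@(wtb∈S , c , cu′≡wtb) m≤|u′| refl
      with s′ , t′ , u′≡s′wt′ ← occurrence (edge-target∈S e) m≤|u′|
      = let x , cs′w≡wx , tb≡xt′ = levi w (t ++ [ b ]) (c ∷ s′ ++ w) t′ wtb≡cs′w++t′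
                                          (m≤n⇒m≤1+n (length-++-≤ʳ w {s′}))
        in s′ , t′ , u′≡s′wt′ , ι x , ⟨⟩-pow (Γ-intro (cs′w∈S′ cs′w≡wx) (c ∷ s′ , (λ ()) , sym cs′w≡wx)) true ,
           ≡⇒≈F (begin
             ι t ++ [ (b , true) ] ≡⟨ map-++ _ t [ b ] ⟨
             ι (t ++ [ b ])        ≡⟨ cong ι tb≡xt′ ⟩
             ι (x ++ t′)           ≡⟨ map-++ _ x t′ ⟩
             ι x ++ ι t′           ∎)
      where
      open ≡-Reasoning
      wtb≡cs′w++t′ : w ++ t ++ [ b ] ≡ (c ∷ s′ ++ w) ++ t′
      wtb≡cs′w++t′ = begin
        w ++ t ++ [ b ]       ≡⟨ ++-assoc w t [ b ] ⟨
        (w ++ t) ++ [ b ]     ≡⟨ cu′≡wtb ⟨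
        c ∷ u′                ≡⟨ cong (c ∷_) u′≡s′wt′ ⟩
        c ∷ s′ ++ w ++ t′     ≡⟨ cong (c ∷_) (++-assoc s′ w t′) ⟨
        (c ∷ s′ ++ w) ++ t′   ∎
      cs′w∈S′ : ∀ {x} → c ∷ s′ ++ w ≡ w ++ x → S (w ++ x)
      cs′w∈S′ cs′w≡wx =
        subst S cs′w≡wx (prefix∈S (c ∷ s′ ++ w) t′ (subst S (trans (++-assoc w t [ b ]) wtb≡cs′w++t′) wtb∈S))

    backward-step : ∀ {u b u′} s t → Edge u′ b u → m ≤ length u′ → u ≡ s ++ w ++ t → Reanchored t [ (b , false) ] u′
    backward-step s t e m≤|u′| u≡swt with initLast t
    backward-step {b = b} {u′} s _ (_ , c , cu≡u′b) _ refl | ys ∷ʳ′ y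
      with cswys≡u′ , refl ← ∷ʳ-injective (c ∷ s ++ w ++ ys) u′
                                 (trans (cong (c ∷_) (trans (++-assoc s (w ++ ys) [ y ]) (cong (s ++_) (++-assoc w ys [ y ]))))
                                        cu≡u′b)
      = c ∷ s , ys , sym cswys≡u′ , [] , ⟨⟩-ε , (begin
        ι (ys ++ [ b ]) ++ [ (b , false) ]           ≡⟨ cong (_++ [ (b , false) ]) (map-++ _ ys [ b ]) ⟩
        (ι ys ++ [ (b , true) ]) ++ [ (b , false) ]  ≡⟨ ++-assoc (ι ys) _ _ ⟩
        ι ys ++ (b , true) ∷ (b , false) ∷ []        ≈⟨ ++-congˡ (ι ys) (cancel-head b true []) ⟩
        ι ys ++ []                                  ≡⟨ ++-identityʳ (ι ys) ⟩
        ι ys                                        ∎)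
      where
      open ≈F-Reasoning
    backward-step {b = b} {u′} s _ e@(u′b∈S , c , cu≡u′b) m≤|u′| refl | []
      with s′ , t′ , u′≡s′wt′ ← occurrence (edge-source∈S e) m≤|u′|
      = s′ , t′ , u′≡s′wt′ , finv (ι (t′ ++ [ b ])) , ⟨⟩-pow t′b∈Γ false , b⁻¹≈
      where
      b⁻¹≈ : [ (b , false) ] ≈F (finv (ι (t′ ++ [ b ])) ++ ι t′)
      b⁻¹≈ = begin
        [ (b , false) ]                        ≈⟨ ++-congˡ [ (b , false) ] (finv-inverseˡ (ι t′)) ⟨
        (b , false) ∷ finv (ι t′) ++ ι t′       ≡⟨ cong (_++ ι t′) (finv-++ (ι t′) [ (b , true) ]) ⟨
        finv (ι t′ ++ [ (b , true) ]) ++ ι t′  ≡⟨ cong (λ g → finv g ++ ι t′) (map-++ _ t′ [ b ]) ⟨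
        finv (ι (t′ ++ [ b ])) ++ ι t′         ∎
        where open ≈F-Reasoning

      csw≡u′b : (c ∷ s) ++ w ≡ u′ ++ [ b ]
      csw≡u′b = trans (cong (λ v → c ∷ s ++ v) (sym (++-identityʳ w))) cu≡u′b

      csw≡s′wt′b : (c ∷ s) ++ w ≡ s′ ++ w ++ t′ ++ [ b ]
      csw≡s′wt′b = begin
        c ∷ s ++ w               ≡⟨ csw≡u′b ⟩
        u′ ++ [ b ]              ≡⟨ cong (_++ [ b ]) u′≡s′wt′ ⟩
        (s′ ++ w ++ t′) ++ [ b ] ≡⟨ ++-assoc s′ (w ++ t′) [ b ] ⟩
        s′ ++ (w ++ t′) ++ [ b ] ≡⟨ cong (s′ ++_) (++-assoc w t′ [ b ]) ⟩
        s′ ++ w ++ t′ ++ [ b ]   ∎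
        where open ≡-Reasoning

      t′b∈Γ : Γ S w (t′ ++ [ b ])
      t′b∈Γ = occurrence⇒Γ s′ (c ∷ s) (t′ ++ [ b ]) (subst S (sym csw≡u′b) u′b∈S) csw≡s′wt′b
                (λ t′b≡[] → case ++-conicalʳ t′ [ b ] t′b≡[] of λ ())

    reanchored-∷ : ∀ {t x ℓ u′ u″} → Reanchored t [ x ] u′ →
                   (∀ s′ t′ → u′ ≡ s′ ++ w ++ t′ → Reanchored t′ ℓ u″) → Reanchored t (x ∷ ℓ) u″
    reanchored-∷ {t} {x} {ℓ} (s₁ , t₁ , u′≡ , h₁ , h₁∈⟨Γ⟩ , tx≈h₁t₁) continue
      with s₂ , t₂ , u″≡ , h₂ , h₂∈⟨Γ⟩ , t₁ℓ≈h₂t₂ ← continue s₁ t₁ u′≡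
      = s₂ , t₂ , u″≡ , h₁ ++ h₂ , ⟨⟩-++ h₁∈⟨Γ⟩ h₂∈⟨Γ⟩ , (begin
        ι t ++ x ∷ ℓ           ≡⟨ ++-assoc (ι t) [ x ] ℓ ⟨
        (ι t ++ [ x ]) ++ ℓ    ≈⟨ ++-congʳ ℓ tx≈h₁t₁ ⟩
        (h₁ ++ ι t₁) ++ ℓ      ≡⟨ ++-assoc h₁ (ι t₁) ℓ ⟩
        h₁ ++ ι t₁ ++ ℓ        ≈⟨ ++-congˡ h₁ t₁ℓ≈h₂t₂ ⟩
        h₁ ++ h₂ ++ ι t₂       ≡⟨ ++-assoc h₁ h₂ (ι t₂) ⟨
        (h₁ ++ h₂) ++ ι t₂     ∎)
      where open ≈F-Reasoning

    walk-reanchored : ∀ {u u′ ℓ} → Walk u u′ ℓ → m ≤ length u → ∀ s t → u ≡ s ++ w ++ t → Reanchored t ℓ u′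
    walk-reanchored nil _ s t u≡swt = s , t , u≡swt , [] , ⟨⟩-ε , ≡⇒≈F (++-identityʳ (ι t))
    walk-reanchored (forward e walk) m≤|u| s t u≡swt =
      reanchored-∷ (forward-step s t e m≤|u′| u≡swt) (walk-reanchored walk m≤|u′|)
      where m≤|u′| = subst (m ≤_) (sym (edge-length e)) m≤|u|
    walk-reanchored (backward e walk) m≤|u| s t u≡swt =
      reanchored-∷ (backward-step s t e m≤|u′| u≡swt) (walk-reanchored walk m≤|u′|)
      where m≤|u′| = subst (m ≤_) (edge-length e) m≤|u|

    closedWalk⊆⟨Γ⟩ : ∀ {s ℓ} → S (s ++ w) → m ≤ length (s ++ w) → Walk (s ++ w) (s ++ w) ℓ → ⟨ Γ S w ⟩ ℓ
    closedWalk⊆⟨Γ⟩ {s} sw∈S m≤|sw| walk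
      with s′ , t′ , sw≡s′wt′ , h , h∈⟨Γ⟩ , ℓ≈ht′ ← walk-reanchored walk m≤|sw| s [] (cong (s ++_) (sym (++-identityʳ w)))
      = ⟨⟩-resp-≈ (≈F-sym ℓ≈ht′) (⟨⟩-++ h∈⟨Γ⟩ (tail t′ sw≡s′wt′))
      where
      tail : ∀ t → s ++ w ≡ s′ ++ w ++ t → ⟨ Γ S w ⟩ (ι t)
      tail []          _ = ⟨⟩-ε
      tail t@(_ ∷ _) sw≡s′wt = ⟨⟩-pow (occurrence⇒Γ s′ s t sw∈S sw≡s′wt (λ ())) true

theorem4p7 : (k : ℕ) (S : WordSet (suc k)) →
    UniformlyRecurrent S → Connected S → (∀ a → S [ a ]) →
    ∀ w → S w → GeneratesFreeGroup (ReturnWord S w)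
theorem4p7 k S (_ , recurrent) ((factorial , biextendable) , connected) letters w w∈S g =
  let m , _ , w-occurs = recurrent w w∈S
      s , |s|≡m , sw∈S = leftExtensions w∈S m
      ℓ , loop , ℓ≈g = closedWalk letters sw∈S g
      m≤|sw| = subst (_≤ length (s ++ w)) |s|≡m (length-++-≤ˡ s)
  in X⊆⟨Y⟩⇒⟨X⟩⊆⟨Y⟩ Γ⊆⟨R⟩ (⟨⟩-resp-≈ ℓ≈g (Recurrence.closedWalk⊆⟨Γ⟩ w m w-occurs sw∈S m≤|sw| loop))
  where
  open FactorialSet factorial
  open Connectedness biextendable connected
  open ReturnWords w
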